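{- For every positive integer $k$, every cylindrical grid of order $2k-2$ contains the cylindrical wall of order $k$ as a topological minor.
   Context: A cylindrical grid of order $n$: a digraph consisting of $n$ pairwise disjoint directed cycles $C_1,\dots,C_n$ of length $2n$ together with $2n$ pairwise vertex-disjoint directed paths $P_1,\dots,P_{2n}$ of length $n-1$, such that each $P_i$ has exactly one vertex in common with each $C_j$ and both endpoints of $P_i$ lie in $V(C_1)\cup V(C_n)$; the paths $P_1,\dots,P_{2n}$ appear on each $C_j$ in this order; for odd $i$ the cycles appear on $P_i$ in order $C_1,\dots,C_n$ and for even $i$ in order $C_n,\dots,C_1$. The cylindrical wall of order $k$ is obtained from the cylindrical grid of order $k$ with the minimum number of vertices by replacing every vertex $v$ of in-degree 2 and out-degree 2 by two vertices $v^{in},v^{out}$ with an arc $(v^{in},v^{out})$, each arc $(u,v)$ becoming $(u,v^{in})$ and each arc $(v,u)$ becoming $(v^{out},u)$. A subdivision of a digraph replaces arcs $(u,v)$ by directed paths from $u$ to $v$ through new vertices; $H$ is a topological minor of $D$ if some subdivision of $H$ is a subgraph of $D$. -}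

module Defs where

open import Data.Nat using (ℕ; zero; suc; _*_; _≡ᵇ_)
open import Data.Nat.DivMod using (_mod_)
open import Data.Fin using (Fin; zero; suc; toℕ; inject₁; fromℕ)
open import Data.Fin.Properties using () renaming (_≟_ to _≟ᶠ_)
open import Data.Bool using (Bool; true; false; T; _∧_; if_then_else_)
open import Data.Product using (Σ; _×_; _,_; proj₁)
open import Data.Product.Properties using (≡-dec)
open import Data.Sum using (_⊎_; inj₁; inj₂)
open import Data.List using (List; []; _++_; map; concatMap; length; filter; allFin)
open import Function using (Injective)
open import Function.Bundles using (_↔_; Inverse)
open import Relation.Binary.PropositionalEquality using (_≡_; _≢_)
open import Relation.Nullary using (Dec)

record Digraph : Set₁ where
  field
    V   : Set
    A   : Set
    src : A → V
    tgt : A → V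

open Digraph public

record _≅_ (D G : Digraph) : Set where
  field
    vIso : V D ↔ V G
    aIso : A D ↔ A G
    src-hom : ∀ a → Inverse.to vIso (src D a) ≡ src G (Inverse.to aIso a)
    tgt-hom : ∀ a → Inverse.to vIso (tgt D a) ≡ tgt G (Inverse.to aIso a)

-- Topological minor: a subdivision of H is a subgraph of D.

Internal : ∀ {ℓ} → Fin (suc ℓ) → Set
Internal {ℓ} i = (0 Data.Nat.< toℕ i) × (toℕ i Data.Nat.< ℓ)

record TopMinor (H D : Digraph) : Set where
  field
    φ     : V H → V D
    φ-inj : Injective _≡_ _≡_ φ
    len   : A H → ℕ
    len≥1 : ∀ e → 1 Data.Nat.≤ len e
    vtx   : (e : A H) → Fin (suc (len e)) → V D
    arc   : (e : A H) → Fin (len e) → A D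
    vtx-first : ∀ e → vtx e zero ≡ φ (src H e)
    vtx-last  : ∀ e → vtx e (fromℕ (len e)) ≡ φ (tgt H e)
    arc-src   : ∀ e i → src D (arc e i) ≡ vtx e (inject₁ i)
    arc-tgt   : ∀ e i → tgt D (arc e i) ≡ vtx e (suc i)
    vtx-inj   : ∀ e → Injective _≡_ _≡_ (vtx e)
    arc-inj   : ∀ e e′ (i : Fin (len e)) (j : Fin (len e′)) →
                arc e i ≡ arc e′ j → (e ≡ e′) × (toℕ i ≡ toℕ j)
    internal-disj : ∀ e e′ (i : Fin (suc (len e))) (j : Fin (suc (len e′))) →
                Internal i → Internal j → vtx e i ≡ vtx e′ j →
                (e ≡ e′) × (toℕ i ≡ toℕ j)
    internal-branch : ∀ e (i : Fin (suc (len e))) (v : V H) →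
                Internal i → vtx e i ≢ φ v

-- The cylindrical grid of order n.
-- Vertex (j , i): the vertex of cycle C_{j+1} lying on path P_{i+1}
-- (0-indexed j : Fin n, i : Fin (2n)).

cnext : ∀ {m} → Fin m → Fin m
cnext {suc m} i = suc (toℕ i) mod suc m

isEven : ℕ → Bool
isEven zero = true
isEven (suc zero) = false
isEven (suc (suc n)) = isEven n

GV : ℕ → Set
GV n = Fin n × Fin (2 * n)

data GArc : ℕ → Set where
  cyc  : ∀ {m} → Fin (suc m) → Fin (2 * suc m) → GArc (suc m)
  rung : ∀ {m} → Fin m → Fin (2 * suc m) → GArc (suc m)

gsrc : ∀ {n} → GArc n → GV n
gsrc (cyc j i) = j , i
gsrc (rung j i) = if isEven (toℕ i) then (inject₁ j , i) else (suc j , i)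

gtgt : ∀ {n} → GArc n → GV n
gtgt (cyc j i) = j , cnext i
gtgt (rung j i) = if isEven (toℕ i) then (suc j , i) else (inject₁ j , i)

CylGrid : ℕ → Digraph
CylGrid n = record { V = GV n ; A = GArc n ; src = gsrc ; tgt = gtgt }

gridArcs : (n : ℕ) → List (GArc n)
gridArcs zero = []
gridArcs (suc m) =
  concatMap (λ j → map (cyc j) (allFin _)) (allFin _) ++
  concatMap (λ j → map (rung j) (allFin _)) (allFin m)

_≟V_ : ∀ {n} (u v : GV n) → Dec (u ≡ v)
_≟V_ = ≡-dec _≟ᶠ_ _≟ᶠ_

gridInDeg : ∀ {n} → GV n → ℕ
gridInDeg {n} v = length (filter (λ a → gtgt a ≟V v) (gridArcs n))

gridOutDeg : ∀ {n} → GV n → ℕ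
gridOutDeg {n} v = length (filter (λ a → gsrc a ≟V v) (gridArcs n))

-- Splitting the vertices selected by s : V → Bool into v^in → v^out.

data SV (D : Digraph) (s : V D → Bool) : Set where
  vin  : V D → SV D s                  -- v^in if v is split, else v itself
  vout : (v : V D) → T (s v) → SV D s

pick : {X : Set} (b : Bool) → (T b → X) → X → X
pick true  f _ = f _
pick false _ x = x

outEnd : (D : Digraph) (s : V D → Bool) → V D → SV D s
outEnd D s v = pick (s v) (vout v) (vin v)

SA : (D : Digraph) (s : V D → Bool) → Set
SA D s = A D ⊎ Σ (V D) (λ v → T (s v))

Split : (D : Digraph) → (V D → Bool) → Digraph
Split D s = record
  { V = SV D s
  ; A = SA D s
  ; src = λ { (inj₁ a) → outEnd D s (src D a) ; (inj₂ (v , p)) → vin v }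
  ; tgt = λ { (inj₁ a) → vin (tgt D a) ; (inj₂ (v , p)) → vout v p }
  }

CylWall : ℕ → Digraph
CylWall k = Split (CylGrid k) (λ v → (gridInDeg v ≡ᵇ 2) ∧ (gridOutDeg v ≡ᵇ 2))

{-# OPTIONS --safe #-}
module Submission where

-- Number the cycles of the wall of order k = m + 2 by rows 0, …, k − 1 and its paths by
-- columns 0, …, 2k − 1.  Counting arcs shows that the split vertices are exactly those on
-- the interior rows.  Row 0 goes to grid row 0, row k − 1 to grid row 2k − 3, and an
-- interior row r to the two grid rows 2r − 1 and 2r, so that the grid path arc between
-- them carries the arc v^in → v^out of every split vertex v: both the direction of that
-- grid arc and the order in which a wall path meets v^in and v^out depend only on the
-- parity of the column.  Wall rungs go to the grid arcs between rows 2j and 2j + 1.  Wall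
-- column c sits on grid column c, and the cycle arcs leaving the last wall column return
-- to column 0 through the 2k − 4 spare grid columns.  This works in every grid of order at
-- least 2k − 2, and topological minors transfer along the isomorphism D ≅ grid.

open import Defs
open import Data.Bool using (Bool; true; false; T; not; _∧_; if_then_else_)
open import Data.Bool.Properties using (not-¬; T-irrelevant; ∧-comm; T?)
open import Data.Empty using (⊥-elim)
open import Data.Fin using (Fin; zero; suc; toℕ; fromℕ; fromℕ<; inject₁; inject≤)
open import Data.Fin.Properties
  using ( toℕ-injective; toℕ-fromℕ; toℕ-fromℕ<; toℕ-inject₁; toℕ-inject≤; toℕ<n
        ; suc-injective; inject₁-injective; inject≤-injective; fromℕ<-injective; fromℕ≢inject₁ )
open import Data.Fin.Relation.Unary.Top using (view; ‵fromℕ; ‵inject₁)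
open import Data.List
  using (List; []; _∷_; _++_; map; concatMap; length; filter; allFin; tabulate)
open import Data.List.Properties using (map-++; map-∘; map-tabulate; tabulate-cong)
open import Data.Nat
  using ( ℕ; zero; suc; pred; _+_; _*_; _∸_; _⊓_; _≤_; _<_; _≟_; _<ᵇ_; _≡ᵇ_
        ; z≤n; s≤s; s≤s⁻¹; ⌊_/2⌋; ⌈_/2⌉ )
open import Data.Nat.DivMod using (_%_; _mod_; n%n≡0; m%n%n≡m%n; m<n⇒m%n≡m; %-distribˡ-+)
open import Data.Nat.ListAction using (sum)
open import Data.Nat.ListAction.Properties using (sum-++)
open import Data.Nat.Properties
  using ( module ≤-Reasoning
        ; +-suc; +-identityʳ; +-comm; +-cancelˡ-≡; +-mono-≤; +-monoʳ-<; *-monoʳ-≤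
        ; ≤-refl; ≤-reflexive; ≤-trans; ≤-<-trans; <⇒≤; <⇒≢; <⇒≱; <-irrefl; ≤∧≢⇒<
        ; n≤1+n; m≤m+n; m<m+n; 1+n≢n; pred-mono-≤; pred[n]≤n; m≤n⇒m<n∨m≡n
        ; m≤n⇒m⊓n≡m; m≥n⇒m⊓n≡n; m+[n∸m]≡n; m<n⇒0<n∸m
        ; <ᵇ⇒<; <⇒<ᵇ; ≡ᵇ⇒≡; ≡⇒≡ᵇ; n≡⌊n+n/2⌋ )
open import Data.Product using (_×_; _,_; proj₁; proj₂; map₁; map₂; uncurry)
open import Data.Sum using (inj₁; inj₂)
open import Function using (_∘_; Injective)
open import Function.Bundles using (Inverse; Injection)
open import Function.Properties.Inverse using (↔-sym; Inverse⇒Injection)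
open import Level using (0ℓ)
open import Relation.Binary.PropositionalEquality
  using (_≡_; _≢_; refl; sym; trans; cong; cong₂; subst; module ≡-Reasoning)
open import Relation.Nullary using (¬_; yes; no)
open import Relation.Nullary.Decidable using (Dec; does; dec-true; dec-false)
open import Relation.Unary using (Pred; Decidable)

record Embedding (G D : Digraph) : Set where
  field
    vmap     : V G → V D
    amap     : A G → A D
    vmap-inj : Injective _≡_ _≡_ vmap
    amap-inj : Injective _≡_ _≡_ amap
    vmap-src : ∀ a → src D (amap a) ≡ vmap (src G a)
    vmap-tgt : ∀ a → tgt D (amap a) ≡ vmap (tgt G a)

≅⇒Embedding : ∀ {D G} → D ≅ G → Embedding G D
≅⇒Embedding {D} {G} D≅G = record
  { vmap     = Vᴵ.from
  ; amap     = Aᴵ.from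
  ; vmap-inj = Injection.injective (Inverse⇒Injection (↔-sym (_≅_.vIso D≅G)))
  ; amap-inj = Injection.injective (Inverse⇒Injection (↔-sym (_≅_.aIso D≅G)))
  ; vmap-src = λ a → hom-from (src D) (src G) (_≅_.src-hom D≅G) a
  ; vmap-tgt = λ a → hom-from (tgt D) (tgt G) (_≅_.tgt-hom D≅G) a
  }
  where
  module Vᴵ = Inverse (_≅_.vIso D≅G)
  module Aᴵ = Inverse (_≅_.aIso D≅G)

  hom-from : (end : A D → V D) (end′ : A G → V G) →
             (∀ a → Vᴵ.to (end a) ≡ end′ (Aᴵ.to a)) →
             ∀ a → end (Aᴵ.from a) ≡ Vᴵ.from (end′ a)
  hom-from end end′ hom a = begin
    end (Aᴵ.from a)                        ≡⟨ Vᴵ.strictlyInverseʳ _ ⟨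
    Vᴵ.from (Vᴵ.to (end (Aᴵ.from a)))      ≡⟨ cong Vᴵ.from (hom _) ⟩
    Vᴵ.from (end′ (Aᴵ.to (Aᴵ.from a)))
      ≡⟨ cong (Vᴵ.from ∘ end′) (Aᴵ.strictlyInverseˡ a) ⟩
    Vᴵ.from (end′ a)                       ∎
    where open ≡-Reasoning

TopMinor-embed : ∀ {H G D} → TopMinor H G → Embedding G D → TopMinor H D
TopMinor-embed t ι = record
  { φ               = vmap ∘ φ
  ; φ-inj           = φ-inj ∘ vmap-inj
  ; len             = len
  ; len≥1           = len≥1
  ; vtx             = λ e → vmap ∘ vtx e
  ; arc             = λ e → amap ∘ arc e
  ; vtx-first       = λ e → cong vmap (vtx-first e)
  ; vtx-last        = λ e → cong vmap (vtx-last e)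
  ; arc-src         = λ e i → trans (vmap-src (arc e i)) (cong vmap (arc-src e i))
  ; arc-tgt         = λ e i → trans (vmap-tgt (arc e i)) (cong vmap (arc-tgt e i))
  ; vtx-inj         = λ e → vtx-inj e ∘ vmap-inj
  ; arc-inj         = λ e e′ i j → arc-inj e e′ i j ∘ amap-inj
  ; internal-disj   = λ e e′ i j p q → internal-disj e e′ i j p q ∘ vmap-inj
  ; internal-branch = λ e i v p → internal-branch e i v p ∘ vmap-inj
  }
  where open TopMinor t; open Embedding ι

data Position {ℓ : ℕ} (i : Fin (suc ℓ)) : Set where
  first    : i ≡ zero → Position i
  last     : i ≡ fromℕ ℓ → Position i
  interior : Internal i → Position i

position : ∀ {ℓ} (i : Fin (suc ℓ)) → Position i
position zero = first refl
position {ℓ} (suc i) with toℕ (suc i) ≟ ℓ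
... | yes i≡ℓ = last (toℕ-injective (trans i≡ℓ (sym (toℕ-fromℕ ℓ))))
... | no  i≢ℓ = interior (s≤s z≤n , ≤∧≢⇒< (s≤s⁻¹ (toℕ<n (suc i))) i≢ℓ)

path-injective : ∀ {X : Set} {ℓ} (p : Fin (suc ℓ) → X) →
  p zero ≢ p (fromℕ ℓ) →
  (∀ i → Internal i → p i ≢ p zero × p i ≢ p (fromℕ ℓ)) →
  (∀ i j → Internal i → Internal j → p i ≡ p j → toℕ i ≡ toℕ j) →
  Injective _≡_ _≡_ p
path-injective p ends≢ avoids interior-inj {i} {j} pi≡pj
  with position i | position j
... | first refl    | first refl    = refl
... | last refl     | last refl     = refl
... | first refl    | last refl     = ⊥-elim (ends≢ pi≡pj)
... | last refl     | first refl    = ⊥-elim (ends≢ (sym pi≡pj))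
... | interior i∘   | first refl    = ⊥-elim (proj₁ (avoids i i∘) pi≡pj)
... | interior i∘   | last refl     = ⊥-elim (proj₂ (avoids i i∘) pi≡pj)
... | first refl    | interior j∘   = ⊥-elim (proj₁ (avoids j j∘) (sym pi≡pj))
... | last refl     | interior j∘   = ⊥-elim (proj₂ (avoids j j∘) (sym pi≡pj))
... | interior i∘   | interior j∘   = toℕ-injective (interior-inj i j i∘ j∘ pi≡pj)

-- Split digraphs

Loopless : Digraph → Set
Loopless D = ∀ a → src D a ≢ tgt D a

merge : ∀ {D s} → SV D s → V D
merge (vin v)    = v
merge (vout v _) = v

outEnd-elim : ∀ D s (P : SV D s → Set) v →
  ((p : T (s v)) → P (vout v p)) → (s v ≡ false → P (vin v)) → P (outEnd D s v)
outEnd-elim D s P v = elim (s v) (vout v)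
  where
  elim : ∀ b (out : T b → SV D s) → (∀ p → P (out p)) → (b ≡ false → P (vin v)) →
         P (pick b out (vin v))
  elim true  out P-out _    = P-out _
  elim false _   _     P-in = P-in refl

merge-outEnd : ∀ D s v → merge (outEnd D s v) ≡ v
merge-outEnd D s v = outEnd-elim D s (λ u → merge u ≡ v) v (λ _ → refl) (λ _ → refl)

Split-loopless : ∀ {D} s → Loopless D → Loopless (Split D s)
Split-loopless {D} s loopless (inj₁ a) eq =
  loopless a (trans (sym (merge-outEnd D s (src D a))) (cong merge eq))
Split-loopless s loopless (inj₂ _) ()

-- Parity and the cyclic successor

isEven-suc : ∀ n → isEven (suc n) ≡ not (isEven n)
isEven-suc zero          = refl
isEven-suc (suc zero)    = refl
isEven-suc (suc (suc n)) = isEven-suc n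

isEven-double : ∀ n → isEven (n + n) ≡ true
isEven-double zero    = refl
isEven-double (suc n) = trans (cong (isEven ∘ suc) (+-suc n n)) (isEven-double n)

isEven-double+1 : ∀ n → isEven (suc (n + n)) ≡ false
isEven-double+1 n = trans (isEven-suc (n + n)) (cong not (isEven-double n))

toℕ-cnext : ∀ {k} (i : Fin (suc k)) → toℕ (cnext i) ≡ suc (toℕ i) % suc k
toℕ-cnext i = toℕ-fromℕ< _

cnext-fromℕ : ∀ k → cnext (fromℕ k) ≡ zero
cnext-fromℕ k = toℕ-injective (begin
  toℕ (cnext (fromℕ k))        ≡⟨ toℕ-cnext (fromℕ k) ⟩
  suc (toℕ (fromℕ k)) % suc k  ≡⟨ cong (λ x → suc x % suc k) (toℕ-fromℕ k) ⟩
  suc k % suc k                ≡⟨ n%n≡0 (suc k) ⟩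
  0                            ∎)
  where open ≡-Reasoning

cnext-inject₁ : ∀ {k} (i : Fin k) → cnext (inject₁ i) ≡ suc i
cnext-inject₁ {k} i = toℕ-injective (begin
  toℕ (cnext (inject₁ i))        ≡⟨ toℕ-cnext (inject₁ i) ⟩
  suc (toℕ (inject₁ i)) % suc k  ≡⟨ cong (λ x → suc x % suc k) (toℕ-inject₁ i) ⟩
  suc (toℕ i) % suc k            ≡⟨ m<n⇒m%n≡m (s≤s (toℕ<n i)) ⟩
  suc (toℕ i)                    ∎)
  where open ≡-Reasoning

cnext-mod : ∀ {k} a → cnext (a mod suc k) ≡ suc a mod suc k
cnext-mod {k} a = toℕ-injective (begin
  toℕ (cnext (a mod d))          ≡⟨ toℕ-cnext (a mod d) ⟩
  suc (toℕ (a mod d)) % d        ≡⟨ cong (λ x → suc x % d) (toℕ-fromℕ< _) ⟩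
  (1 + a % d) % d                ≡⟨ %-distribˡ-+ 1 (a % d) d ⟩
  (1 % d + a % d % d) % d        ≡⟨ cong (λ x → (1 % d + x) % d) (m%n%n≡m%n a d) ⟩
  (1 % d + a % d) % d            ≡⟨ %-distribˡ-+ 1 a d ⟨
  suc a % d                      ≡⟨ toℕ-fromℕ< _ ⟨
  toℕ (suc a mod d)              ∎)
  where open ≡-Reasoning; d = suc k

cprev : ∀ {k} → Fin (suc k) → Fin (suc k)
cprev zero    = fromℕ _
cprev (suc i) = inject₁ i

cnext-cprev : ∀ {k} (c : Fin (suc k)) → cnext (cprev c) ≡ c
cnext-cprev zero    = cnext-fromℕ _
cnext-cprev (suc i) = cnext-inject₁ i

cnext-injective : ∀ {k} → Injective _≡_ _≡_ (cnext {suc k})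
cnext-injective {k} {i} {j} eq with view i | view j
... | ‵fromℕ      | ‵fromℕ      = refl
... | ‵fromℕ      | ‵inject₁ j′
  with () ← trans (sym (cnext-fromℕ k)) (trans eq (cnext-inject₁ j′))
... | ‵inject₁ i′ | ‵fromℕ
  with () ← trans (sym (cnext-inject₁ i′)) (trans eq (cnext-fromℕ k))
... | ‵inject₁ i′ | ‵inject₁ j′ =
  cong inject₁ (suc-injective (trans (sym (cnext-inject₁ i′)) (trans eq (cnext-inject₁ j′))))

cnext-flips-parity : ∀ {k} (i : Fin (2 * suc k)) → isEven (toℕ (cnext i)) ≡ not (isEven (toℕ i))
cnext-flips-parity {k} i with view i
... | ‵fromℕ = begin
  isEven (toℕ (cnext (fromℕ K)))    ≡⟨ cong (isEven ∘ toℕ) (cnext-fromℕ K) ⟩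
  true                              ≡⟨ cong not (isEven-double+1 k) ⟨
  not (isEven (suc (k + k)))        ≡⟨ cong (not ∘ isEven) (+-suc k k) ⟨
  not (isEven (k + suc k))          ≡⟨ cong (λ x → not (isEven (k + suc x))) (+-identityʳ k) ⟨
  not (isEven (k + suc (k + 0)))    ≡⟨ cong (not ∘ isEven) (toℕ-fromℕ K) ⟨
  not (isEven (toℕ (fromℕ K)))      ∎
  where open ≡-Reasoning; K = k + suc (k + 0)
... | ‵inject₁ j = begin
  isEven (toℕ (cnext (inject₁ j)))  ≡⟨ cong (isEven ∘ toℕ) (cnext-inject₁ j) ⟩
  isEven (suc (toℕ j))              ≡⟨ isEven-suc (toℕ j) ⟩
  not (isEven (toℕ j))              ≡⟨ cong (not ∘ isEven) (toℕ-inject₁ j) ⟨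
  not (isEven (toℕ (inject₁ j)))    ∎
  where open ≡-Reasoning

cnext-no-fixpoint : ∀ {k} (i : Fin (2 * suc k)) → cnext i ≢ i
cnext-no-fixpoint i eq = not-¬ (cong (isEven ∘ toℕ) eq) (cnext-flips-parity i)

bit : Bool → ℕ
bit b = if b then 1 else 0

if-T : ∀ {A : Set} {b} {x y : A} → T b → (if b then x else y) ≡ x
if-T {b = true} _ = refl

if-¬T : ∀ {A : Set} {b} {x y : A} → ¬ T b → (if b then x else y) ≡ y
if-¬T {b = false} _  = refl
if-¬T {b = true}  ¬t = ⊥-elim (¬t _)

indicator : ∀ {A : Set} → Dec A → ℕ
indicator a? = bit (does a?)

indicator-yes : ∀ {A : Set} (a? : Dec A) → A → indicator a? ≡ 1
indicator-yes a? a = cong bit (dec-true a? a)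

indicator-no : ∀ {A : Set} (a? : Dec A) → ¬ A → indicator a? ≡ 0
indicator-no a? ¬a = cong bit (dec-false a? ¬a)

length-filter≡sum : ∀ {A : Set} {P : Pred A 0ℓ} (P? : Decidable P) xs →
  length (filter P? xs) ≡ sum (map (indicator ∘ P?) xs)
length-filter≡sum P? []       = refl
length-filter≡sum P? (x ∷ xs) with does (P? x)
... | true  = cong suc (length-filter≡sum P? xs)
... | false = length-filter≡sum P? xs

sum-concatMap : ∀ {A B : Set} (g : B → ℕ) (f : A → List B) xs →
  sum (map g (concatMap f xs)) ≡ sum (map (sum ∘ map g ∘ f) xs)
sum-concatMap g f []       = refl
sum-concatMap g f (x ∷ xs) = begin
  sum (map g (f x ++ concatMap f xs))                ≡⟨ cong sum (map-++ g (f x) _) ⟩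
  sum (map g (f x) ++ map g (concatMap f xs))        ≡⟨ sum-++ (map g (f x)) _ ⟩
  sum (map g (f x)) + sum (map g (concatMap f xs))
      ≡⟨ cong (sum (map g (f x)) +_) (sum-concatMap g f xs) ⟩
  sum (map g (f x)) + sum (map (sum ∘ map g ∘ f) xs) ∎
  where open ≡-Reasoning

sum-map-allFin : ∀ {n} (g : Fin n → ℕ) → sum (map g (allFin n)) ≡ sum (tabulate g)
sum-map-allFin g = cong sum (map-tabulate (λ i → i) g)

sum-tabulate-cong : ∀ {n} {f g : Fin n → ℕ} → (∀ i → f i ≡ g i) →
                    sum (tabulate f) ≡ sum (tabulate g)
sum-tabulate-cong f≗g = cong sum (tabulate-cong f≗g)

sum-tabulate-zero : ∀ {n} (g : Fin n → ℕ) → (∀ i → g i ≡ 0) → sum (tabulate g) ≡ 0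
sum-tabulate-zero {zero}  g g≡0 = refl
sum-tabulate-zero {suc n} g g≡0 rewrite g≡0 zero = sum-tabulate-zero (g ∘ suc) (g≡0 ∘ suc)

sum-tabulate-single : ∀ {n} (g : Fin n → ℕ) i₀ → (∀ i → i ≢ i₀ → g i ≡ 0) →
                      sum (tabulate g) ≡ g i₀
sum-tabulate-single g zero g≡0 rewrite sum-tabulate-zero (g ∘ suc) (λ i → g≡0 (suc i) λ ()) =
  +-identityʳ (g zero)
sum-tabulate-single g (suc i₀) g≡0 rewrite g≡0 zero (λ ()) =
  sum-tabulate-single (g ∘ suc) i₀ (λ i i≢i₀ → g≡0 (suc i) (i≢i₀ ∘ suc-injective))

count-unique : ∀ {n} {P : Pred (Fin n) 0ℓ} (P? : Decidable P) i₀ → (∀ i → P i → i ≡ i₀) →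
  sum (tabulate (indicator ∘ P?)) ≡ indicator (P? i₀)
count-unique P? i₀ unique =
  sum-tabulate-single (indicator ∘ P?) i₀ (λ i i≢i₀ → indicator-no (P? i) (i≢i₀ ∘ unique i))

count-none : ∀ {n} {P : Pred (Fin n) 0ℓ} (P? : Decidable P) → (∀ i → ¬ P i) →
  sum (tabulate (indicator ∘ P?)) ≡ 0
count-none P? none = sum-tabulate-zero (indicator ∘ P?) (λ i → indicator-no (P? i) (none i))

-- The cylindrical grid

row col : ∀ {k} → GV k → ℕ
row v = toℕ (proj₁ v)
col v = toℕ (proj₂ v)

GV-≡ : ∀ {k} {u v : GV k} → row u ≡ row v → col u ≡ col v → u ≡ v
GV-≡ r≡ c≡ = cong₂ _,_ (toℕ-injective r≡) (toℕ-injective c≡)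

rung-src : ∀ {k} (j : Fin k) i → gsrc (rung j i) ≡ ((if isEven (toℕ i) then inject₁ j else suc j) , i)
rung-src j i with isEven (toℕ i)
... | true  = refl
... | false = refl

rung-tgt : ∀ {k} (j : Fin k) i → gtgt (rung j i) ≡ ((if isEven (toℕ i) then suc j else inject₁ j) , i)
rung-tgt j i with isEven (toℕ i)
... | true  = refl
... | false = refl

cyc-injective : ∀ {k} {a a′ : Fin (suc k)} {b b′} → cyc a b ≡ cyc a′ b′ → a ≡ a′ × b ≡ b′
cyc-injective refl = refl , refl

rung-injective : ∀ {k} {a a′ : Fin k} {b b′} → rung a b ≡ rung a′ b′ → a ≡ a′ × b ≡ b′
rung-injective refl = refl , refl

row-rung-src : ∀ {k} (j : Fin k) i →
               row (gsrc (rung j i)) ≡ (if isEven (toℕ i) then toℕ j else suc (toℕ j))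
row-rung-src j i with isEven (toℕ i)
... | true  = toℕ-inject₁ j
... | false = refl

row-rung-tgt : ∀ {k} (j : Fin k) i →
               row (gtgt (rung j i)) ≡ (if isEven (toℕ i) then suc (toℕ j) else toℕ j)
row-rung-tgt j i with isEven (toℕ i)
... | true  = refl
... | false = toℕ-inject₁ j

col-rung-src : ∀ {k} (j : Fin k) i → col (gsrc (rung j i)) ≡ toℕ i
col-rung-src j i = cong (toℕ ∘ proj₂) (rung-src j i)

col-rung-tgt : ∀ {k} (j : Fin k) i → col (gtgt (rung j i)) ≡ toℕ i
col-rung-tgt j i = cong (toℕ ∘ proj₂) (rung-tgt j i)

rung-ends : ∀ {k} {j : Fin k} {i : Fin (2 * suc k)} {u w : GV (suc k)} {a y} →
  toℕ j ≡ a → toℕ i ≡ y →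
  row u ≡ (if isEven y then a else suc a) → row w ≡ (if isEven y then suc a else a) →
  col u ≡ y → col w ≡ y → gsrc (rung j i) ≡ u × gtgt (rung j i) ≡ w
rung-ends {j = j} {i} refl refl row-u row-w col-u col-w =
  GV-≡ (trans (row-rung-src j i) (sym row-u)) (trans (col-rung-src j i) (sym col-u)) ,
  GV-≡ (trans (row-rung-tgt j i) (sym row-w)) (trans (col-rung-tgt j i) (sym col-w))

CylGrid-loopless : ∀ {k} → Loopless (CylGrid (suc k))
CylGrid-loopless (cyc j i)  eq = cnext-no-fixpoint i (sym (cong proj₂ eq))
CylGrid-loopless (rung j i) eq =
  apart (isEven (toℕ i)) (cong proj₁ (trans (sym (rung-src j i)) (trans eq (rung-tgt j i))))
  where
  inject₁≢suc : inject₁ j ≢ suc j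
  inject₁≢suc eq = 1+n≢n (trans (sym (cong toℕ eq)) (toℕ-inject₁ j))
  apart : ∀ e → (if e then inject₁ j else suc j) ≢ (if e then suc j else inject₁ j)
  apart true  = inject₁≢suc
  apart false = inject₁≢suc ∘ sym

degree-cyc+rung : ∀ {k} (end : GArc (suc k) → GV (suc k)) v →
  length (filter (λ a → end a ≟V v) (gridArcs (suc k))) ≡
  sum (tabulate λ j → sum (tabulate λ i → indicator (end (cyc j i) ≟V v))) +
  sum (tabulate λ j → sum (tabulate λ i → indicator (end (rung j i) ≟V v)))
degree-cyc+rung {k} end v = begin
  length (filter (λ a → end a ≟V v) (arcs cyc ++ arcs rung))
      ≡⟨ length-filter≡sum _ (arcs cyc ++ arcs rung) ⟩
  sum (map h (arcs cyc ++ arcs rung))                         ≡⟨ cong sum (map-++ h (arcs cyc) _) ⟩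
  sum (map h (arcs cyc) ++ map h (arcs rung))                 ≡⟨ sum-++ (map h (arcs cyc)) _ ⟩
  sum (map h (arcs cyc)) + sum (map h (arcs rung))
      ≡⟨ cong₂ _+_ (sum-arcs cyc) (sum-arcs rung) ⟩
  _                                                           ∎
  where
  open ≡-Reasoning
  h : GArc (suc k) → ℕ
  h a = indicator (end a ≟V v)
  arcs : ∀ {a} → (Fin a → Fin (2 * suc k) → GArc (suc k)) → List (GArc (suc k))
  arcs {a} f = concatMap (λ j → map (f j) (allFin _)) (allFin a)
  sum-arcs : ∀ {a} (f : Fin a → Fin (2 * suc k) → GArc (suc k)) →
             sum (map h (arcs f)) ≡ sum (tabulate λ j → sum (tabulate λ i → h (f j i)))
  sum-arcs {a} f = begin
    sum (map h (arcs f))                                      ≡⟨ sum-concatMap h _ (allFin a) ⟩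
    sum (map (λ j → sum (map h (map (f j) (allFin _)))) (allFin a))
      ≡⟨ sum-map-allFin (λ j → sum (map h (map (f j) (allFin _)))) ⟩
    sum (tabulate λ j → sum (map h (map (f j) (allFin _))))
      ≡⟨ sum-tabulate-cong (λ j → trans (cong sum (sym (map-∘ {g = h} {f = f j} (allFin _))))
                                        (sum-map-allFin (h ∘ f j))) ⟩
    sum (tabulate λ j → sum (tabulate λ i → h (f j i)))       ∎

count-cycle-arcs : ∀ {k} (σ : Fin (2 * suc k) → Fin (2 * suc k)) → Injective _≡_ _≡_ σ →
  ∀ (r : Fin (suc k)) {c} i₀ → σ i₀ ≡ c →
  sum (tabulate λ j → sum (tabulate λ i → indicator ((j , σ i) ≟V (r , c)))) ≡ 1
count-cycle-arcs {k} σ σ-inj r {c} i₀ σi₀≡c = begin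
  sum (tabulate inner)
    ≡⟨ sum-tabulate-single inner r (λ j j≢r →
         count-none (λ i → (j , σ i) ≟V (r , c)) (λ i eq → j≢r (cong proj₁ eq))) ⟩
  inner r
    ≡⟨ count-unique (λ i → (r , σ i) ≟V (r , c)) i₀ (λ i eq →
         σ-inj (trans (cong proj₂ eq) (sym σi₀≡c))) ⟩
  indicator ((r , σ i₀) ≟V (r , c))
    ≡⟨ indicator-yes ((r , σ i₀) ≟V (r , c)) (cong (r ,_) σi₀≡c) ⟩
  1 ∎
  where
  open ≡-Reasoning
  inner : Fin (suc k) → ℕ
  inner j = sum (tabulate λ i → indicator ((j , σ i) ≟V (r , c)))

count-rung-arcs : ∀ {k} (end : GArc (suc k) → GV (suc k)) →
  (∀ j i → proj₂ (end (rung j i)) ≡ i) →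
  ∀ v → sum (tabulate λ j → sum (tabulate λ i → indicator (end (rung j i) ≟V v))) ≡
        sum (tabulate λ j → indicator (end (rung j (proj₂ v)) ≟V v))
count-rung-arcs end col v = sum-tabulate-cong λ j →
  count-unique (λ i → end (rung j i) ≟V v) (proj₂ v)
    (λ i eq → trans (sym (col j i)) (cong proj₂ eq))

count-suc : ∀ {k} (r : Fin (suc k)) c →
  sum (tabulate λ (j : Fin k) → indicator ((suc j , c) ≟V (r , c))) ≡ bit (0 <ᵇ toℕ r)
count-suc zero    c = count-none (λ j → (suc j , c) ≟V (zero , c)) (λ j ())
count-suc (suc r) c =
  trans (count-unique (λ j → (suc j , c) ≟V (suc r , c)) r (λ j eq → suc-injective (cong proj₁ eq)))
        (indicator-yes ((suc r , c) ≟V (suc r , c)) refl)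

count-inject₁ : ∀ {k} (r : Fin (suc k)) c →
  sum (tabulate λ (j : Fin k) → indicator ((inject₁ j , c) ≟V (r , c))) ≡ bit (toℕ r <ᵇ k)
count-inject₁ {k} r c with view r
... | ‵fromℕ = trans
  (count-none (λ j → (inject₁ j , c) ≟V (fromℕ k , c)) (λ j eq → fromℕ≢inject₁ (sym (cong proj₁ eq))))
  (sym (if-¬T (<-irrefl (toℕ-fromℕ k) ∘ <ᵇ⇒< _ k)))
... | ‵inject₁ r′ = begin
  sum (tabulate λ j → indicator ((inject₁ j , c) ≟V (inject₁ r′ , c)))
      ≡⟨ count-unique (λ j → (inject₁ j , c) ≟V (inject₁ r′ , c)) r′
                      (λ j eq → inject₁-injective (cong proj₁ eq)) ⟩
  indicator ((inject₁ r′ , c) ≟V (inject₁ r′ , c))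
      ≡⟨ indicator-yes ((inject₁ r′ , c) ≟V (inject₁ r′ , c)) refl ⟩
  1                                                 ≡⟨ if-T (<⇒<ᵇ r′<k) ⟨
  bit (toℕ (inject₁ r′) <ᵇ k)                       ∎
  where
  open ≡-Reasoning
  r′<k : toℕ (inject₁ r′) < k
  r′<k = subst (_< k) (sym (toℕ-inject₁ r′)) (toℕ<n r′)

rungInto rungOutOf : ∀ {k} → Fin (suc k) → Fin (2 * suc k) → Bool
rungInto  {k} r c = if isEven (toℕ c) then 0 <ᵇ toℕ r else toℕ r <ᵇ k
rungOutOf {k} r c = if isEven (toℕ c) then toℕ r <ᵇ k else 0 <ᵇ toℕ r

gridInDeg-rungs : ∀ {k} (r : Fin (suc k)) c → gridInDeg (r , c) ≡ 1 + bit (rungInto r c)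
gridInDeg-rungs {k} r c = begin
  gridInDeg (r , c)   ≡⟨ degree-cyc+rung gtgt (r , c) ⟩
  _                   ≡⟨ cong₂ _+_ (count-cycle-arcs cnext cnext-injective r (cprev c) (cnext-cprev c))
                                   (count-rung-arcs gtgt (λ j i → cong proj₂ (rung-tgt j i)) (r , c)) ⟩
  1 + sum (tabulate λ j → indicator (gtgt (rung j c) ≟V (r , c)))
      ≡⟨ cong (1 +_) (sum-tabulate-cong λ j →
           cong (λ x → indicator (x ≟V (r , c))) (rung-tgt j c)) ⟩
  1 + _               ≡⟨ cong (1 +_) (by-parity (isEven (toℕ c))) ⟩
  1 + bit (rungInto r c) ∎
  where
  open ≡-Reasoning
  by-parity : ∀ e →
    sum (tabulate λ j → indicator (((if e then suc j else inject₁ j) , c) ≟V (r , c))) ≡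
    bit (if e then 0 <ᵇ toℕ r else toℕ r <ᵇ k)
  by-parity true  = count-suc r c
  by-parity false = count-inject₁ r c

gridOutDeg-rungs : ∀ {k} (r : Fin (suc k)) c → gridOutDeg (r , c) ≡ 1 + bit (rungOutOf r c)
gridOutDeg-rungs {k} r c = begin
  gridOutDeg (r , c)  ≡⟨ degree-cyc+rung gsrc (r , c) ⟩
  _                   ≡⟨ cong₂ _+_ (count-cycle-arcs (λ i → i) (λ eq → eq) r c refl)
                                   (count-rung-arcs gsrc (λ j i → cong proj₂ (rung-src j i)) (r , c)) ⟩
  1 + sum (tabulate λ j → indicator (gsrc (rung j c) ≟V (r , c)))
      ≡⟨ cong (1 +_) (sum-tabulate-cong λ j →
           cong (λ x → indicator (x ≟V (r , c))) (rung-src j c)) ⟩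
  1 + _               ≡⟨ cong (1 +_) (by-parity (isEven (toℕ c))) ⟩
  1 + bit (rungOutOf r c) ∎
  where
  open ≡-Reasoning
  by-parity : ∀ e →
    sum (tabulate λ j → indicator (((if e then inject₁ j else suc j) , c) ≟V (r , c))) ≡
    bit (if e then toℕ r <ᵇ k else 0 <ᵇ toℕ r)
  by-parity true  = count-inject₁ r c
  by-parity false = count-suc r c

innerRow : ℕ → ℕ → Bool
innerRow k r = (0 <ᵇ r) ∧ (r <ᵇ k)

indeg2∧outdeg2≡innerRow : ∀ {k} (r : Fin (suc k)) c →
  (gridInDeg (r , c) ≡ᵇ 2) ∧ (gridOutDeg (r , c) ≡ᵇ 2) ≡ innerRow k (toℕ r)
indeg2∧outdeg2≡innerRow {k} r c = begin
  (gridInDeg (r , c) ≡ᵇ 2) ∧ (gridOutDeg (r , c) ≡ᵇ 2)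
    ≡⟨ cong₂ (λ x y → (x ≡ᵇ 2) ∧ (y ≡ᵇ 2)) (gridInDeg-rungs r c) (gridOutDeg-rungs r c) ⟩
  (bit (rungInto r c) ≡ᵇ 1) ∧ (bit (rungOutOf r c) ≡ᵇ 1)
    ≡⟨ cong₂ _∧_ (bit≡ᵇ1 (rungInto r c)) (bit≡ᵇ1 (rungOutOf r c)) ⟩
  rungInto r c ∧ rungOutOf r c
    ≡⟨ swap-∧ (isEven (toℕ c)) ⟩
  innerRow k (toℕ r) ∎
  where
  open ≡-Reasoning
  bit≡ᵇ1 : ∀ b → (bit b ≡ᵇ 1) ≡ b
  bit≡ᵇ1 true  = refl
  bit≡ᵇ1 false = refl
  swap-∧ : ∀ {x y} e → (if e then x else y) ∧ (if e then y else x) ≡ x ∧ y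
  swap-∧         true  = refl
  swap-∧ {x} {y} false = ∧-comm y x

-- The wall inside the grid

⌈n+n/2⌉≡n : ∀ n → ⌈ n + n /2⌉ ≡ n
⌈n+n/2⌉≡n zero    = refl
⌈n+n/2⌉≡n (suc n) = cong suc (trans (cong ⌊_/2⌋ (+-suc n n)) (⌈n+n/2⌉≡n n))

double-injective : ∀ {m n} → m + m ≡ n + n → m ≡ n
double-injective {m} {n} eq = trans (n≡⌊n+n/2⌋ m) (trans (cong ⌊_/2⌋ eq) (sym (n≡⌊n+n/2⌋ n)))

-- The wall of order m + 2 in the grid of order n + 1 ≥ 2(m + 2) − 2.
module WallInGrid (m n : ℕ) (m+m<n : m + m < n) where

  W N lastCol : ℕ
  W       = suc (suc m)
  N       = 2 * suc n
  lastCol = pred (2 * W)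

  lastCol<N : lastCol < N
  lastCol<N = *-monoʳ-≤ 2 (s≤s (≤-<-trans (m≤m+n m m) m+m<n))

  col≤lastCol : (c : Fin (2 * W)) → toℕ c ≤ lastCol
  col≤lastCol c = s≤s⁻¹ (toℕ<n c)

  -- The length of the grid path carrying a cycle arc that leaves wall column x.
  span : ℕ → ℕ
  span x = if x ≡ᵇ lastCol then N ∸ lastCol else 1

  span-last : span lastCol ≡ N ∸ lastCol
  span-last = if-T (≡⇒≡ᵇ lastCol lastCol refl)

  span-short : ∀ {x} → x < lastCol → span x ≡ 1
  span-short {x} x<last = if-¬T (<⇒≢ x<last ∘ ≡ᵇ⇒≡ x lastCol)

  span-pos : ∀ x → 0 < span x
  span-pos x with x ≡ᵇ lastCol
  ... | true  = m<n⇒0<n∸m lastCol<N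
  ... | false = s≤s z≤n

  short-offset : ∀ {x i} → x < lastCol → i < span x → i ≡ 0
  short-offset x<last i<span with subst (_ <_) (span-short x<last) i<span
  ... | s≤s z≤n = refl

  column-owner : ∀ {x i} → x ≤ lastCol → i < span x → (x + i) ⊓ lastCol ≡ x
  column-owner {x} x≤last i<span with m≤n⇒m<n∨m≡n x≤last
  ... | inj₁ x<last rewrite short-offset x<last i<span | +-identityʳ x = m≤n⇒m⊓n≡m x≤last
  ... | inj₂ refl = m≥n⇒m⊓n≡n (m≤m+n lastCol _)

  column-in-range : ∀ {x i} → x ≤ lastCol → i < span x → x + i < N
  column-in-range {x} {i} x≤last i<span with m≤n⇒m<n∨m≡n x≤last
  ... | inj₁ x<last rewrite short-offset x<last i<span =
    subst (_< N) (sym (+-identityʳ x)) (≤-<-trans x≤last lastCol<N)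
  ... | inj₂ refl = subst (lastCol + i <_) (m+[n∸m]≡n (<⇒≤ lastCol<N))
                          (+-monoʳ-< lastCol (subst (i <_) span-last i<span))

  interior-wraps : ∀ {x i} → x ≤ lastCol → 0 < i → i < span x → x ≡ lastCol
  interior-wraps x≤last 0<i i<span with m≤n⇒m<n∨m≡n x≤last
  ... | inj₁ x<last = ⊥-elim (<⇒≢ 0<i (sym (short-offset x<last i<span)))
  ... | inj₂ x≡last = x≡last

  path-columns-injective : ∀ {x x′ i i′} → x ≤ lastCol → x′ ≤ lastCol →
    i < span x → i′ < span x′ → x + i ≡ x′ + i′ → x ≡ x′ × i ≡ i′
  path-columns-injective {x} {x′} {i} {i′} x≤ x′≤ i< i′< eq = x≡x′ , i≡i′
    where
    x≡x′ : x ≡ x′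
    x≡x′ = trans (sym (column-owner x≤ i<)) (trans (cong (_⊓ lastCol) eq) (column-owner x′≤ i′<))
    i≡i′ : i ≡ i′
    i≡i′ = +-cancelˡ-≡ x i i′ (trans eq (cong (_+ i′) (sym x≡x′)))

  wrap-next : (c : Fin (2 * W)) → (toℕ c + span (toℕ c)) % N ≡ toℕ (cnext c)
  wrap-next c with view c
  ... | ‵fromℕ = begin
    (toℕ (fromℕ lastCol) + span (toℕ (fromℕ lastCol))) % N
        ≡⟨ cong (λ x → (x + span x) % N) (toℕ-fromℕ lastCol) ⟩
    (lastCol + span lastCol) % N       ≡⟨ cong (λ s → (lastCol + s) % N) span-last ⟩
    (lastCol + (N ∸ lastCol)) % N      ≡⟨ cong (_% N) (m+[n∸m]≡n (<⇒≤ lastCol<N)) ⟩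
    N % N                              ≡⟨ n%n≡0 N ⟩
    0                                  ≡⟨ cong toℕ (cnext-fromℕ lastCol) ⟨
    toℕ (cnext (fromℕ lastCol))        ∎
    where open ≡-Reasoning
  ... | ‵inject₁ c′ = begin
    (toℕ (inject₁ c′) + span (toℕ (inject₁ c′))) % N
        ≡⟨ cong (λ x → (x + span x) % N) (toℕ-inject₁ c′) ⟩
    (toℕ c′ + span (toℕ c′)) % N       ≡⟨ cong (λ s → (toℕ c′ + s) % N) (span-short (toℕ<n c′)) ⟩
    (toℕ c′ + 1) % N                   ≡⟨ cong (_% N) (+-comm (toℕ c′) 1) ⟩
    suc (toℕ c′) % N                   ≡⟨ m<n⇒m%n≡m (≤-<-trans (toℕ<n c′) lastCol<N) ⟩
    suc (toℕ c′)                       ≡⟨ cong toℕ (cnext-inject₁ c′) ⟨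
    toℕ (cnext (inject₁ c′))           ∎
    where open ≡-Reasoning

  inner : ℕ → Bool
  inner = innerRow (suc m)

  -- Wall row r occupies the grid rows top r ≤ bottom r, which ⌈_/2⌉ maps back to r.
  top bottom : ℕ → ℕ
  top r    = pred (r + r)
  bottom r = if inner r then suc (top r) else top r

  -- The Bool is the parity of the column; on even columns rungs go from row r to r + 1.
  entryRow exitRow : ℕ → Bool → ℕ
  entryRow r e = if e then top r else bottom r
  exitRow  r e = if e then bottom r else top r

  inner⇒≤m : ∀ r → T (inner r) → r ≤ m
  inner⇒≤m (suc r) t = s≤s⁻¹ (<ᵇ⇒< (suc r) (suc m) t)

  top-suc : ∀ r → top (suc r) ≡ suc (r + r)
  top-suc r = +-suc r r

  bottom-inner : ∀ r → T (inner r) → bottom r ≡ r + r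
  bottom-inner (suc r) t = if-T t

  bottom-¬inner : ∀ r → ¬ T (inner r) → bottom r ≡ top r
  bottom-¬inner r = if-¬T

  bottom-double : ∀ {r} → r ≤ m → bottom r ≡ r + r
  bottom-double {zero}  _   = refl
  bottom-double {suc r} r<m = bottom-inner (suc r) (<⇒<ᵇ (s≤s r<m))

  ⌈top/2⌉ : ∀ r → ⌈ top r /2⌉ ≡ r
  ⌈top/2⌉ zero    = refl
  ⌈top/2⌉ (suc r) = trans (cong ⌈_/2⌉ (top-suc r)) (cong suc (sym (n≡⌊n+n/2⌋ r)))

  ⌈bottom/2⌉ : ∀ r → ⌈ bottom r /2⌉ ≡ r
  ⌈bottom/2⌉ r with T? (inner r)
  ... | yes t  = trans (cong ⌈_/2⌉ (bottom-inner r t)) (⌈n+n/2⌉≡n r)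
  ... | no  ¬t = trans (cong ⌈_/2⌉ (bottom-¬inner r ¬t)) (⌈top/2⌉ r)

  ⌈entryRow/2⌉ : ∀ r e → ⌈ entryRow r e /2⌉ ≡ r
  ⌈entryRow/2⌉ r true  = ⌈top/2⌉ r
  ⌈entryRow/2⌉ r false = ⌈bottom/2⌉ r

  ⌈exitRow/2⌉ : ∀ r e → ⌈ exitRow r e /2⌉ ≡ r
  ⌈exitRow/2⌉ r true  = ⌈bottom/2⌉ r
  ⌈exitRow/2⌉ r false = ⌈top/2⌉ r

  exitRow≡entryRow-not : ∀ r e → exitRow r e ≡ entryRow r (not e)
  exitRow≡entryRow-not r true  = refl
  exitRow≡entryRow-not r false = refl

  ¬inner⇒entryRow≡exitRow : ∀ r → ¬ T (inner r) → ∀ e → entryRow r e ≡ exitRow r e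
  ¬inner⇒entryRow≡exitRow r ¬t true  = sym (bottom-¬inner r ¬t)
  ¬inner⇒entryRow≡exitRow r ¬t false = bottom-¬inner r ¬t

  inner⇒entryRow≢exitRow : ∀ r → T (inner r) → ∀ e → entryRow r e ≢ exitRow r e
  inner⇒entryRow≢exitRow r t true  eq = 1+n≢n (sym (trans eq (if-T t)))
  inner⇒entryRow≢exitRow r t false eq = 1+n≢n (trans (sym (if-T t)) eq)

  top≤ : ∀ {r} → r ≤ suc m → top r ≤ suc (m + m)
  top≤ r≤ = ≤-trans (pred-mono-≤ (+-mono-≤ r≤ r≤)) (≤-reflexive (+-suc m m))

  bottom≤ : ∀ {r} → r ≤ suc m → bottom r ≤ suc (m + m)
  bottom≤ {r} r≤ with T? (inner r)
  ... | yes t  = subst (_≤ suc (m + m)) (sym (bottom-inner r t))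
                       (≤-trans (+-mono-≤ (inner⇒≤m r t) (inner⇒≤m r t)) (n≤1+n (m + m)))
  ... | no  ¬t = subst (_≤ suc (m + m)) (sym (bottom-¬inner r ¬t)) (top≤ r≤)

  row-fits : ∀ {x} → x ≤ suc (m + m) → x < suc n
  row-fits x≤ = s≤s (≤-trans x≤ m+m<n)

  entryRow-fits : ∀ {r} → r ≤ suc m → ∀ e → entryRow r e < suc n
  entryRow-fits r≤ true  = row-fits (top≤ r≤)
  entryRow-fits r≤ false = row-fits (bottom≤ r≤)

  exitRow-fits : ∀ {r} → r ≤ suc m → ∀ e → exitRow r e < suc n
  exitRow-fits r≤ true  = row-fits (bottom≤ r≤)
  exitRow-fits r≤ false = row-fits (top≤ r≤)

  double<n : ∀ {j} → j ≤ m → j + j < n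
  double<n j≤m = ≤-<-trans (+-mono-≤ j≤m j≤m) m+m<n

  top<n : ∀ r → T (inner r) → top r < n
  top<n r t = ≤-<-trans (≤-trans pred[n]≤n (+-mono-≤ (inner⇒≤m r t) (inner⇒≤m r t))) m+m<n

  double≢top : ∀ j r → T (inner r) → j + j ≢ top r
  double≢top j (suc r) _ eq = not-¬ (cong isEven (trans eq (top-suc r)))
    (trans (isEven-double j) (cong not (sym (isEven-double+1 r))))

  exitRow-rung : ∀ {j} → j ≤ m → ∀ e →
                 exitRow (if e then j else suc j) e ≡ (if e then j + j else suc (j + j))
  exitRow-rung j≤m true  = bottom-double j≤m
  exitRow-rung {j} _ false = top-suc j

  entryRow-rung : ∀ {j} → j ≤ m → ∀ e →
                  entryRow (if e then suc j else j) e ≡ (if e then suc (j + j) else j + j)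
  entryRow-rung {j} _ true  = top-suc j
  entryRow-rung j≤m false = bottom-double j≤m

  entryRow-split : ∀ r → T (inner r) → ∀ e → entryRow r e ≡ (if e then top r else suc (top r))
  entryRow-split r t true  = refl
  entryRow-split r t false = if-T t

  exitRow-split : ∀ r → T (inner r) → ∀ e → exitRow r e ≡ (if e then suc (top r) else top r)
  exitRow-split r t true  = if-T t
  exitRow-split r t false = refl

  isSplit : GV W → Bool
  isSplit v = (gridInDeg v ≡ᵇ 2) ∧ (gridOutDeg v ≡ᵇ 2)

  Wall : Digraph
  Wall = CylWall W

  split⇒inner : ∀ r c → T (isSplit (r , c)) → T (inner (toℕ r))
  split⇒inner r c = subst T (indeg2∧outdeg2≡innerRow r c)

  unsplit⇒¬inner : ∀ r c → isSplit (r , c) ≡ false → ¬ T (inner (toℕ r))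
  unsplit⇒¬inner r c unsplit = subst T (trans (sym (indeg2∧outdeg2≡innerRow r c)) unsplit)

  row≤ : (r : Fin W) → toℕ r ≤ suc m
  row≤ r = s≤s⁻¹ (toℕ<n r)

  rowOf : V Wall → ℕ
  rowOf (vin (r , c))    = entryRow (toℕ r) (isEven (toℕ c))
  rowOf (vout (r , c) _) = exitRow  (toℕ r) (isEven (toℕ c))

  rowOf-fits : ∀ v → rowOf v < suc n
  rowOf-fits (vin (r , c))    = entryRow-fits (row≤ r) (isEven (toℕ c))
  rowOf-fits (vout (r , c) _) = exitRow-fits  (row≤ r) (isEven (toℕ c))

  wallColumn : Fin (2 * W) → Fin N
  wallColumn c = inject≤ c lastCol<N

  φ : V Wall → GV (suc n)
  φ v = fromℕ< (rowOf-fits v) , wallColumn (proj₂ (merge v))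

  row-φ : ∀ v → row (φ v) ≡ rowOf v
  row-φ v = toℕ-fromℕ< (rowOf-fits v)

  col-φ : ∀ v → col (φ v) ≡ col (merge v)
  col-φ v = toℕ-inject≤ (proj₂ (merge v)) lastCol<N

  ⌈rowOf/2⌉ : ∀ v → ⌈ rowOf v /2⌉ ≡ row (merge v)
  ⌈rowOf/2⌉ (vin (r , c))    = ⌈entryRow/2⌉ (toℕ r) (isEven (toℕ c))
  ⌈rowOf/2⌉ (vout (r , c) _) = ⌈exitRow/2⌉  (toℕ r) (isEven (toℕ c))

  rowOf-outEnd : ∀ v → rowOf (outEnd (CylGrid W) isSplit v) ≡ exitRow (row v) (isEven (col v))
  rowOf-outEnd v@(r , c) =
    outEnd-elim (CylGrid W) isSplit (λ u → rowOf u ≡ exitRow (toℕ r) (isEven (toℕ c))) v (λ _ → refl)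
      (λ unsplit → ¬inner⇒entryRow≡exitRow (toℕ r) (unsplit⇒¬inner r c unsplit) (isEven (toℕ c)))

  row-φ-outEnd : ∀ v → row (φ (outEnd (CylGrid W) isSplit v)) ≡ exitRow (row v) (isEven (col v))
  row-φ-outEnd v = trans (row-φ (outEnd (CylGrid W) isSplit v)) (rowOf-outEnd v)

  col-φ-outEnd : ∀ v → col (φ (outEnd (CylGrid W) isSplit v)) ≡ col v
  col-φ-outEnd v =
    trans (col-φ (outEnd (CylGrid W) isSplit v)) (cong col (merge-outEnd (CylGrid W) isSplit v))

  merge×rowOf-injective : ∀ u v → merge u ≡ merge v → rowOf u ≡ rowOf v → u ≡ v
  merge×rowOf-injective (vin _)          (vin _)     refl _ = refl
  merge×rowOf-injective (vout _ s)       (vout _ s′) refl _ = cong (vout _) (T-irrelevant s s′)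
  merge×rowOf-injective (vin (r , c))    (vout _ s)  refl eq =
    ⊥-elim (inner⇒entryRow≢exitRow (toℕ r) (split⇒inner r c s) (isEven (toℕ c)) eq)
  merge×rowOf-injective (vout (r , c) s) (vin _)     refl eq =
    ⊥-elim (inner⇒entryRow≢exitRow (toℕ r) (split⇒inner r c s) (isEven (toℕ c)) (sym eq))

  φ-injective : Injective _≡_ _≡_ φ
  φ-injective {u} {v} eq = merge×rowOf-injective u v (GV-≡ rows cols) rowOfs
    where
    rowOfs : rowOf u ≡ rowOf v
    rowOfs = trans (sym (row-φ u)) (trans (cong row eq) (row-φ v))
    rows : row (merge u) ≡ row (merge v)
    rows = trans (sym (⌈rowOf/2⌉ u)) (trans (cong ⌈_/2⌉ rowOfs) (⌈rowOf/2⌉ v))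
    cols : col (merge u) ≡ col (merge v)
    cols = trans (sym (col-φ u)) (trans (cong col eq) (col-φ v))

  len : A Wall → ℕ
  len (inj₁ (cyc _ c))  = span (toℕ c)
  len (inj₁ (rung _ _)) = 1
  len (inj₂ _)          = 1

  pathVertex : Fin W → Fin (2 * W) → ℕ → GV (suc n)
  pathVertex r c i = fromℕ< (exitRow-fits (row≤ r) (isEven (toℕ c))) , (toℕ c + i) mod N

  vtx : (e : A Wall) → Fin (suc (len e)) → GV (suc n)
  vtx (inj₁ (cyc r c)) i = pathVertex r c (toℕ i)
  vtx e zero             = φ (src Wall e)
  vtx e (suc _)          = φ (tgt Wall e)

  cycFrom : GV (suc n) → GArc (suc n)
  cycFrom v = cyc (proj₁ v) (proj₂ v)

  arc : (e : A Wall) → Fin (len e) → GArc (suc n)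
  arc (inj₁ (cyc r c))     i = cycFrom (pathVertex r c (toℕ (inject₁ i)))
  arc (inj₁ (rung j c))    _ = rung (fromℕ< (double<n (s≤s⁻¹ (toℕ<n j)))) (wallColumn c)
  arc (inj₂ ((r , c) , s)) _ = rung (fromℕ< (top<n (toℕ r) (split⇒inner r c s))) (wallColumn c)

  row-pathVertex : ∀ r c i → row (pathVertex r c i) ≡ exitRow (toℕ r) (isEven (toℕ c))
  row-pathVertex r c i = toℕ-fromℕ< _

  col-pathVertex : ∀ r c i → col (pathVertex r c i) ≡ (toℕ c + i) % N
  col-pathVertex r c i = toℕ-fromℕ< _

  col-pathVertex-inside : ∀ r c {i} → i < span (toℕ c) → col (pathVertex r c i) ≡ toℕ c + i
  col-pathVertex-inside r c i< =
    trans (col-pathVertex r c _) (m<n⇒m%n≡m (column-in-range (col≤lastCol c) i<))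

  pathVertex-injective : ∀ r c r′ c′ {i i′} → i < span (toℕ c) → i′ < span (toℕ c′) →
                         pathVertex r c i ≡ pathVertex r′ c′ i′ → cyc r c ≡ cyc r′ c′ × i ≡ i′
  pathVertex-injective r c r′ c′ {i} {i′} i< i′< eq =
    cong₂ cyc (toℕ-injective r≡r′) (toℕ-injective (proj₁ c≡c′×i≡i′)) , proj₂ c≡c′×i≡i′
    where
    rows : exitRow (toℕ r) (isEven (toℕ c)) ≡ exitRow (toℕ r′) (isEven (toℕ c′))
    rows = trans (sym (row-pathVertex r c i)) (trans (cong row eq) (row-pathVertex r′ c′ i′))
    r≡r′ : toℕ r ≡ toℕ r′
    r≡r′ = trans (sym (⌈exitRow/2⌉ (toℕ r) (isEven (toℕ c))))
                 (trans (cong ⌈_/2⌉ rows) (⌈exitRow/2⌉ (toℕ r′) (isEven (toℕ c′))))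
    c≡c′×i≡i′ : toℕ c ≡ toℕ c′ × i ≡ i′
    c≡c′×i≡i′ = path-columns-injective (col≤lastCol c) (col≤lastCol c′) i< i′<
      (trans (sym (col-pathVertex-inside r c i<)) (trans (cong col eq) (col-pathVertex-inside r′ c′ i′<)))

  len≥1 : ∀ e → 1 ≤ len e
  len≥1 (inj₁ (cyc _ c))  = span-pos (toℕ c)
  len≥1 (inj₁ (rung _ _)) = s≤s z≤n
  len≥1 (inj₂ _)          = s≤s z≤n

  vtx-first : ∀ e → vtx e zero ≡ φ (src Wall e)
  vtx-first (inj₁ (cyc r c)) = GV-≡
    (trans (row-pathVertex r c 0) (sym (row-φ-outEnd (r , c))))
    (trans (col-pathVertex-inside r c (span-pos (toℕ c)))
           (trans (+-identityʳ _) (sym (col-φ-outEnd (r , c)))))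
  vtx-first (inj₁ (rung _ _)) = refl
  vtx-first (inj₂ _)          = refl

  vtx-last : ∀ e → vtx e (fromℕ (len e)) ≡ φ (tgt Wall e)
  vtx-last (inj₁ (cyc r c)) = GV-≡
    (begin
      row (pathVertex r c (span (toℕ c)))           ≡⟨ row-pathVertex r c (span (toℕ c)) ⟩
      exitRow (toℕ r) (isEven (toℕ c))
        ≡⟨ exitRow≡entryRow-not (toℕ r) (isEven (toℕ c)) ⟩
      entryRow (toℕ r) (not (isEven (toℕ c)))
        ≡⟨ cong (entryRow (toℕ r)) (cnext-flips-parity {suc m} c) ⟨
      entryRow (toℕ r) (isEven (toℕ (cnext c)))     ≡⟨ row-φ (vin (r , cnext c)) ⟨
      row (φ (vin (r , cnext c)))                   ∎)
    (begin
      col (pathVertex r c (toℕ (fromℕ (span (toℕ c)))))   ≡⟨ col-pathVertex r c _ ⟩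
      (toℕ c + toℕ (fromℕ (span (toℕ c)))) % N            ≡⟨ cong (λ i → (toℕ c + i) % N) (toℕ-fromℕ _) ⟩
      (toℕ c + span (toℕ c)) % N                          ≡⟨ wrap-next c ⟩
      toℕ (cnext c)                                       ≡⟨ col-φ (vin (r , cnext c)) ⟨
      col (φ (vin (r , cnext c)))                         ∎)
    where open ≡-Reasoning
  vtx-last (inj₁ (rung _ _)) = refl
  vtx-last (inj₂ _)          = refl


  wall-rung-ends : ∀ j c → gsrc (arc (inj₁ (rung j c)) zero) ≡ φ (src Wall (inj₁ (rung j c))) ×
                           gtgt (arc (inj₁ (rung j c)) zero) ≡ φ (tgt Wall (inj₁ (rung j c)))
  wall-rung-ends j c = rung-ends (toℕ-fromℕ< _) (toℕ-inject≤ c lastCol<N) row-src row-tgt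
    (trans (col-φ-outEnd (gsrc (rung j c))) (col-rung-src j c))
    (trans (col-φ (vin (gtgt (rung j c)))) (col-rung-tgt j c))
    where
    j≤m : toℕ j ≤ m
    j≤m = s≤s⁻¹ (toℕ<n j)
    e : Bool
    e = isEven (toℕ c)
    row-src : row (φ (outEnd (CylGrid W) isSplit (gsrc (rung j c)))) ≡
              (if e then toℕ j + toℕ j else suc (toℕ j + toℕ j))
    row-src = trans (row-φ-outEnd (gsrc (rung j c)))
      (trans (cong₂ exitRow (row-rung-src j c) (cong isEven (col-rung-src j c))) (exitRow-rung j≤m e))
    row-tgt : row (φ (vin (gtgt (rung j c)))) ≡ (if e then suc (toℕ j + toℕ j) else toℕ j + toℕ j)
    row-tgt = trans (row-φ (vin (gtgt (rung j c))))
      (trans (cong₂ entryRow (row-rung-tgt j c) (cong isEven (col-rung-tgt j c))) (entryRow-rung j≤m e))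

  split-arc-ends : ∀ r c s → gsrc (arc (inj₂ ((r , c) , s)) zero) ≡ φ (vin (r , c)) ×
                             gtgt (arc (inj₂ ((r , c) , s)) zero) ≡ φ (vout (r , c) s)
  split-arc-ends r c s = rung-ends (toℕ-fromℕ< _) (toℕ-inject≤ c lastCol<N)
    (trans (row-φ (vin (r , c)))    (entryRow-split (toℕ r) (split⇒inner r c s) (isEven (toℕ c))))
    (trans (row-φ (vout (r , c) s)) (exitRow-split  (toℕ r) (split⇒inner r c s) (isEven (toℕ c))))
    (col-φ (vin (r , c))) (col-φ (vout (r , c) s))

  arc-src : ∀ e i → gsrc (arc e i) ≡ vtx e (inject₁ i)
  arc-src (inj₁ (cyc r c))     i    = refl
  arc-src (inj₁ (rung j c))    zero = proj₁ (wall-rung-ends j c)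
  arc-src (inj₂ ((r , c) , s)) zero = proj₁ (split-arc-ends r c s)

  arc-tgt : ∀ e i → gtgt (arc e i) ≡ vtx e (suc i)
  arc-tgt (inj₁ (cyc r c)) i = cong (proj₁ (pathVertex r c 0) ,_) (begin
    cnext ((toℕ c + toℕ (inject₁ i)) mod N)   ≡⟨ cnext-mod (toℕ c + toℕ (inject₁ i)) ⟩
    suc (toℕ c + toℕ (inject₁ i)) mod N       ≡⟨ cong (λ x → suc (toℕ c + x) mod N) (toℕ-inject₁ i) ⟩
    suc (toℕ c + toℕ i) mod N                 ≡⟨ cong (_mod N) (+-suc (toℕ c) (toℕ i)) ⟨
    (toℕ c + suc (toℕ i)) mod N               ∎)
    where open ≡-Reasoning
  arc-tgt (inj₁ (rung j c))    zero = proj₂ (wall-rung-ends j c)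
  arc-tgt (inj₂ ((r , c) , s)) zero = proj₂ (split-arc-ends r c s)

  no-interior : {i : Fin 2} → ¬ Internal i
  no-interior {zero}     (() , _)
  no-interior {suc zero} (_ , s≤s ())

  internal-disj : ∀ e e′ (i : Fin (suc (len e))) (j : Fin (suc (len e′))) →
    Internal i → Internal j → vtx e i ≡ vtx e′ j → (e ≡ e′) × (toℕ i ≡ toℕ j)
  internal-disj (inj₁ (cyc r c)) (inj₁ (cyc r′ c′)) i j (_ , i<) (_ , j<) eq =
    map₁ (cong inj₁) (pathVertex-injective r c r′ c′ i< j< eq)
  internal-disj (inj₁ (rung _ _)) _                 _ _ i∘ _  _ = ⊥-elim (no-interior i∘)
  internal-disj (inj₂ _)          _                 _ _ i∘ _  _ = ⊥-elim (no-interior i∘)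
  internal-disj (inj₁ (cyc _ _))  (inj₁ (rung _ _)) _ _ _  j∘ _ = ⊥-elim (no-interior j∘)
  internal-disj (inj₁ (cyc _ _))  (inj₂ _)          _ _ _  j∘ _ = ⊥-elim (no-interior j∘)

  internal-branch : ∀ e (i : Fin (suc (len e))) v → Internal i → vtx e i ≢ φ v
  internal-branch (inj₁ (cyc r c)) i v (0<i , i<) eq = <⇒≱ (m<m+n lastCol 0<i) (begin
    lastCol + toℕ i      ≡⟨ cong (_+ toℕ i) (interior-wraps (col≤lastCol c) 0<i i<) ⟨
    toℕ c + toℕ i        ≡⟨ col-pathVertex-inside r c i< ⟨
    col (pathVertex r c (toℕ i)) ≡⟨ cong col eq ⟩
    col (φ v)            ≡⟨ col-φ v ⟩
    col (merge v)        ≤⟨ col≤lastCol (proj₂ (merge v)) ⟩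
    lastCol              ∎)
    where open ≤-Reasoning
  internal-branch (inj₁ (rung _ _)) i v i∘ = ⊥-elim (no-interior i∘)
  internal-branch (inj₂ _)          i v i∘ = ⊥-elim (no-interior i∘)

  split-arc-≡ : ∀ {u v} {s : T (isSplit u)} {s′ : T (isSplit v)} → u ≡ v →
                _≡_ {A = A Wall} (inj₂ (u , s)) (inj₂ (v , s′))
  split-arc-≡ {s = s} {s′} refl = cong (λ t → inj₂ (_ , t)) (T-irrelevant s s′)

  rung-index-≡ : ∀ {x y} .{p : x < n} .{q : y < n} {z z′} →
                 rung (fromℕ< p) z ≡ rung (fromℕ< q) z′ → x ≡ y
  rung-index-≡ {x} {y} eq = fromℕ<-injective x y _ _ (proj₁ (rung-injective eq))

  rung-column-≡ : ∀ {a a′ : Fin n} {c c′} → rung a (wallColumn c) ≡ rung a′ (wallColumn c′) → c ≡ c′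
  rung-column-≡ eq = inject≤-injective _ _ _ _ (proj₂ (rung-injective eq))

  arc-inj : ∀ e e′ (i : Fin (len e)) (j : Fin (len e′)) → arc e i ≡ arc e′ j → (e ≡ e′) × (toℕ i ≡ toℕ j)
  arc-inj (inj₁ (cyc r c)) (inj₁ (cyc r′ c′)) i j eq
    with pathVertex-injective r c r′ c′ (inject₁< i) (inject₁< j)
           (uncurry (cong₂ _,_) (cyc-injective eq))
    where
    inject₁< : ∀ {ℓ} (i : Fin ℓ) → toℕ (inject₁ i) < ℓ
    inject₁< i = subst (_< _) (sym (toℕ-inject₁ i)) (toℕ<n i)
  ... | same , i≡j = cong inj₁ same , trans (sym (toℕ-inject₁ i)) (trans i≡j (toℕ-inject₁ j))
  arc-inj (inj₁ (rung j c)) (inj₁ (rung j′ c′)) zero zero eq =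
    cong inj₁ (cong₂ rung (toℕ-injective (double-injective (rung-index-≡ eq))) (rung-column-≡ eq)) , refl
  arc-inj (inj₂ ((r , c) , s)) (inj₂ ((r′ , c′) , s′)) zero zero eq =
    split-arc-≡ (GV-≡ r≡r′ (cong toℕ (rung-column-≡ eq))) , refl
    where
    r≡r′ : toℕ r ≡ toℕ r′
    r≡r′ = trans (sym (⌈top/2⌉ (toℕ r))) (trans (cong ⌈_/2⌉ (rung-index-≡ eq)) (⌈top/2⌉ (toℕ r′)))
  arc-inj (inj₁ (rung j _)) (inj₂ ((r , c) , s)) zero zero eq =
    ⊥-elim (double≢top (toℕ j) (toℕ r) (split⇒inner r c s) (rung-index-≡ eq))
  arc-inj (inj₂ ((r , c) , s)) (inj₁ (rung j _)) zero zero eq =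
    ⊥-elim (double≢top (toℕ j) (toℕ r) (split⇒inner r c s) (rung-index-≡ (sym eq)))
  arc-inj (inj₁ (cyc _ _))  (inj₁ (rung _ _)) _ _ ()
  arc-inj (inj₁ (cyc _ _))  (inj₂ _)          _ _ ()
  arc-inj (inj₁ (rung _ _)) (inj₁ (cyc _ _))  _ _ ()
  arc-inj (inj₂ _)          (inj₁ (cyc _ _))  _ _ ()

  Wall-loopless : Loopless Wall
  Wall-loopless = Split-loopless isSplit CylGrid-loopless

  vtx-inj : ∀ e → Injective _≡_ _≡_ (vtx e)
  vtx-inj e = path-injective (vtx e) ends-differ avoids-ends
    (λ i j i∘ j∘ eq → proj₂ (internal-disj e e i j i∘ j∘ eq))
    where
    ends-differ : vtx e zero ≢ vtx e (fromℕ (len e))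
    ends-differ eq = Wall-loopless e (φ-injective (trans (sym (vtx-first e)) (trans eq (vtx-last e))))
    avoids-ends : ∀ i → Internal i → vtx e i ≢ vtx e zero × vtx e i ≢ vtx e (fromℕ (len e))
    avoids-ends i i∘ =
      (λ eq → internal-branch e i (src Wall e) i∘ (trans eq (vtx-first e))) ,
      (λ eq → internal-branch e i (tgt Wall e) i∘ (trans eq (vtx-last e)))

  cylWall-topMinor-cylGrid : TopMinor Wall (CylGrid (suc n))
  cylWall-topMinor-cylGrid = record
    { φ               = φ
    ; φ-inj           = φ-injective
    ; len             = len
    ; len≥1           = len≥1
    ; vtx             = vtx
    ; arc             = arc
    ; vtx-first       = vtx-first
    ; vtx-last        = vtx-last
    ; arc-src         = arc-src
    ; arc-tgt         = arc-tgt
    ; vtx-inj         = vtx-inj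
    ; arc-inj         = arc-inj
    ; internal-disj   = internal-disj
    ; internal-branch = internal-branch
    }

mainTheorem7 : (k : ℕ) → 2 ≤ k → (D : Digraph) → D ≅ CylGrid (2 * k ∸ 2) →
    TopMinor (CylWall k) D
mainTheorem7 (suc (suc m)) _ D D≅grid =
  TopMinor-embed (WallInGrid.cylWall-topMinor-cylGrid m (suc (m + m)) ≤-refl)
                 (≅⇒Embedding (subst (λ g → D ≅ CylGrid g) order D≅grid))
  where
  order : 2 * suc (suc m) ∸ 2 ≡ suc (suc (m + m))
  order = begin
    m + suc (suc (m + 0))   ≡⟨ +-suc m (suc (m + 0)) ⟩
    suc (m + suc (m + 0))   ≡⟨ cong (λ (x : ℕ) → suc x) (+-suc m (m + 0)) ⟩
    suc (suc (m + (m + 0))) ≡⟨ cong (λ x → suc (suc (m + x))) (+-identityʳ m) ⟩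
    suc (suc (m + m))       ∎
    where open ≡-Reasoning
mainTheorem7 (suc zero) (s≤s ())
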